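{- There is an absolute constant $c>0$ such that the following holds. Let $P$ be a string of length $m$, let $r$ be an even integer with $1<r\le m+1$, and let $Q$ be a string of length $n$. Then the simulation of the segment automaton $C(P,r)$ on $Q$ contains at most $c\,(n/r+\mathrm{occ})$ transitions that are heavy or accepting. Here $\mathrm{occ}$ is the number of occurrences of $P$ in $Q$.
   Context: Strings are indexed from $1$. $A[i]$ denotes the $i$-th character of $A$ and $A[i,j]$ the substring from position $i$ to position $j$. KMP automaton $K(P)$. Its states are $0,1,\dots,m$, where state $s$ corresponds to the prefix $P[1,s]$. - For $0\le s<m$ there is a forward transition from $s$ to $s+1$ labeled with the character $P[s+1]$. The forward transition from $m-1$ to $m$ is the accepting transition. - For $0<s\le m$ there is a failure transition from $s$ to $\mathrm{fail}(s)$, where $P[1,\mathrm{fail}(s)]$ is the longest prefix of $P$ that is a proper suffix of $P[1,s]$. Segment automaton $C(P,r)$. Let $z=2\lfloor (m+1)/r\rfloor+1$. For $0\le i<z$, define the segment $S_i=[l_i,r_i]$ by $l_i=i\cdot r/2$ and $r_i=\min(l_i+r-1,m)$. Its size is $|S_i|=r_i-l_i+1$. - States of $C$ are the pairs $(i,j)$ with $0\le i<z$ and $0\le j<|S_i|$. The state $(i,j)$ corresponds to the state $l_i+j$ of $K(P)$. - For each transition $(s,s')$ of $K(P)$ and each $i$ with $s\in[l_i,r_i]$: - if $s'\in[l_i,r_i]$, then $C$ has a light transition from $(i,s-l_i)$ to $(i,s'-l_i)$; - otherwise, $C$ has a heavy transition from $(i,s-l_i)$ to $(i',s'-l_{i'})$,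 where $S_{i'}$ is the unique segment containing $s'$ if only one segment contains it, and otherwise is the segment containing $s'$ in its left half, i.e. with $s'-l_{i'}<r/2$ (equivalently, the segment of largest index containing $s'$). - Each such transition inherits its type from the transition of $K(P)$: forward (with the same label), failure, or accepting. Simulation of $C(P,r)$ on $Q$. Start in state $(0,0)$ and process $Q[1],\dots,Q[n]$ in order. To process a character $\alpha$ in the current state: if the forward transition out of the current state exists and is labeled $\alpha$, follow it and move to the next character. Otherwise, if the current state corresponds to state $0$ of $K(P)$, stay in a state corresponding to $0$ and move to the next character. Otherwise, follow the failure transition out of the current state and try again with the same character $\alpha$. The simulation is the sequence of transitions followed. $\mathrm{occ}$ is the number of positions $k$ with $Q[k-m+1,k]=P$. -}

module Defs where

open import Data.Nat using (ℕ; zero; suc; _+_; _*_; _∸_; _≤_; _<_; _⊓_)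
open import Data.Nat.Properties using (_≟_; _≤?_; _<?_)
open import Data.Nat.DivMod using (_/_)
open import Data.Bool using (Bool; true; false; if_then_else_; _∧_; _∨_)
open import Data.List using (List; []; _∷_; length; take; drop; filter; upTo)
open import Data.List.Properties using (≡-dec)
open import Data.Maybe using (Maybe; just; nothing)
open import Data.Product using (_×_; _,_; proj₁; proj₂)
open import Relation.Nullary.Decidable using (does)
open import Relation.Binary using (DecidableEquality)

-- Strings are lists over an alphabet A with decidable equality.
-- Positions are 1-indexed in the paper; `at k P` is the character P[k+1].
at : {A : Set} → ℕ → List A → Maybe A
at k       []       = nothing
at zero    (x ∷ xs) = just x
at (suc k) (x ∷ xs) = at k xs

-- natural-number division with a harmless default for divisor 0
div : ℕ → ℕ → ℕ
div a zero    = 0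
div a (suc b) = a / suc b

module _ {A : Set} (_≟A_ : DecidableEquality A) (P : List A) where

  m : ℕ
  m = length P

  isBorder : ℕ → ℕ → Bool
  isBorder s k = does (k <? s) ∧ does (≡-dec _≟A_ (take k P) (drop (s ∸ k) (take s P)))

  failSearch : ℕ → ℕ → ℕ
  failSearch s zero    = 0
  failSearch s (suc k) = if isBorder s (suc k) then suc k else failSearch s k

  -- fail(s) for 0 < s ≤ m: longest prefix of P that is a proper suffix of P[1,s]
  fail : ℕ → ℕ
  fail s = failSearch s (s ∸ 1)

  module Seg (r : ℕ) where

    half : ℕ
    half = div r 2

    z : ℕ
    z = 2 * div (m + 1) r + 1

    lSeg : ℕ → ℕ
    lSeg i = i * half

    rSeg : ℕ → ℕ
    rSeg i = (lSeg i + r ∸ 1) ⊓ m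

    inSeg : ℕ → ℕ → Bool
    inSeg i s = does (lSeg i ≤? s) ∧ does (s ≤? rSeg i)

    -- largest index i < k with s ∈ S_i  (default 0 if none)
    segSearch : ℕ → ℕ → ℕ
    segSearch s zero    = 0
    segSearch s (suc i) = if inSeg i s then i else segSearch s i

    target : ℕ → ℕ
    target s = segSearch s z

    -- states (i , j) of C, corresponding to state l_i + j of K(P)
    State : Set
    State = ℕ × ℕ

    data Kind : Set where
      forward : A → Kind
      failure : Kind

    record Trans : Set where
      constructor trans
      field
        src       : State
        tgt       : State
        kind      : Kind
        heavy     : Bool
        accepting : Bool   -- the forward transition from m-1 to m

    -- the transition of C out of (i , j) induced by the K(P)-transition (l_i + j , s')
    mkTrans : State → ℕ → Kind → Bool → Trans
    mkTrans (i , j) s' k acc =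
      if inSeg i s'
      then trans (i , j) (i , s' ∸ lSeg i) k false acc
      else trans (i , j) (target s' , s' ∸ lSeg (target s')) k true acc

    -- The fuel bounds the length of the failure chain
    -- (which is at most m since fail strictly decreases the K-state);
    -- it is instantiated with m + 1 and never runs out.
    -- does the forward transition out of K-state s exist and carry label α?
    fwdOK : ℕ → A → Bool
    fwdOK s α with at s P
    ... | just c  = does (c ≟A α) ∧ does (s <? m)
    ... | nothing = false

    step : ℕ → State → A → List Trans × State
    step zero st α = [] , st
    step (suc f) (i , j) α =
      if fwdOK s α
      then (let t = mkTrans (i , j) (suc s) (forward α) (does (suc s ≟ m))
            in (t ∷ []) , Trans.tgt t)
      else (if does (s ≟ 0)
            then ([] , (i , j))
            else (let t    = mkTrans (i , j) (fail s) failure false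
                      rest = step f (Trans.tgt t) α
                  in (t ∷ proj₁ rest) , proj₂ rest))
      where
      s : ℕ
      s = lSeg i + j

    run : List A → State → List Trans
    run []      st = []
    run (α ∷ Q) st = let res = step (m + 1) st α in proj₁ res Data.List.++ run Q (proj₂ res)

    simulation : List A → List Trans
    simulation Q = run Q (0 , 0)

    isHeavyOrAccepting : Trans → Bool
    isHeavyOrAccepting t = Trans.heavy t ∨ Trans.accepting t

    countHA : List Trans → ℕ
    countHA []       = 0
    countHA (t ∷ ts) = (if isHeavyOrAccepting t then 1 else 0) + countHA ts

  heavyOrAccepting : ℕ → List A → ℕ
  heavyOrAccepting r Q = Seg.countHA r (Seg.simulation r Q)

  occAt : List A → ℕ → Bool
  occAt Q k = does (m ≤? k) ∧ does (≡-dec _≟A_ (take m (drop (k ∸ m) Q)) P)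

  countUpTo : List A → List ℕ → ℕ
  countUpTo Q []       = 0
  countUpTo Q (k ∷ ks) = (if occAt Q k then 1 else 0) + countUpTo Q ks

  occ : List A → ℕ
  occ Q = countUpTo Q (upTo (suc (length Q)))

module Submission where

open import Defs
open import Data.Nat using (ℕ; zero; suc; _+_; _*_; _∸_; _≤_; _<_; _%_; _/_; z≤n; s≤s; NonZero)
open import Data.Nat.Properties
open import Data.Nat.DivMod using (m≡m%n+[m/n]*n; m%n<n; m/n*n≤m)
open import Data.Nat.Tactic.RingSolver using (solve-∀)
open import Data.Bool using (Bool; true; false; if_then_else_; _∧_)
open import Data.Bool.Properties using (∧-conicalˡ; ∧-conicalʳ)
open import Data.Maybe using (just; nothing)
open import Data.List using (List; []; _∷_; length; take; drop; _++_; applyUpTo)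
open import Data.List.Properties using (≡-dec; ++-assoc; ++-identityʳ; take++drop≡id; length-++; take-all)
open import Data.Product using (Σ; _×_; _,_; proj₁; proj₂)
open import Data.Sum using (inj₁; inj₂)
open import Data.Empty using (⊥-elim)
open import Relation.Nullary using (Dec; yes; no; ¬_; does)
open import Relation.Nullary.Decidable using (dec-true; _×-dec_)
open import Relation.Binary using (DecidableEquality)
open import Relation.Binary.PropositionalEquality

-- Let h = r/2.  The proof is an amortized (potential) argument.  A state (i , j) of
-- C(P,r) is at offset j in the segment S_i, which starts at the K-state l_i = i·h; its
-- potential is  Φ(i , j) = 8·l_i + 6·j + 12·(j ∸ h).  For the moves of the simulation:
--   * a light forward move raises Φ by at most 18;
--   * a heavy forward move leaves S_i at its right end (j = r - 1) and enters the left
--     half of a segment starting at or after l_i + h, so r + ΔΦ ≤ 18;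
--   * a light failure move does not raise Φ;
--   * a heavy failure move enters the left half of a segment starting at least h before
--     l_i, so r + ΔΦ ≤ 0.
-- Each character causes at most one forward move, an accepting move marks an occurrence
-- of P, and Φ starts at 0; summing over Q gives  r·#(heavy or accepting) ≤ 18·|Q| + r·occ.

does-true : ∀ {X : Set} (d : Dec X) → does d ≡ true → X
does-true (yes x) _  = x
does-true (no _)  ()

bit : Bool → ℕ
bit b = if b then 1 else 0

<[s/d]*d+d : ∀ s d .{{_ : NonZero d}} → s < (s / d) * d + d
<[s/d]*d+d s d = begin-strict
    s                       ≡⟨ m≡m%n+[m/n]*n s d ⟩
    s % d + (s / d) * d     <⟨ +-monoˡ-< ((s / d) * d) (m%n<n s d) ⟩
    d + (s / d) * d         ≡⟨ +-comm d _ ⟩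
    (s / d) * d + d         ∎
  where open ≤-Reasoning

div*d≤ : ∀ s d → div s d * d ≤ s
div*d≤ s zero    = z≤n
div*d≤ s (suc d) = m/n*n≤m s (suc d)

<div*d+d : ∀ s d → 0 < d → s < div s d * d + d
<div*d+d s (suc d) _ = <[s/d]*d+d s (suc d)

drop-prefix : ∀ {A : Set} (u xs : List A) → drop (length u) (u ++ xs) ≡ xs
drop-prefix []      xs = refl
drop-prefix (_ ∷ u) xs = drop-prefix u xs

take-prefix : ∀ {A : Set} (u xs : List A) → take (length u) (u ++ xs) ≡ u
take-prefix []      xs = refl
take-prefix (x ∷ u) xs = cong (x ∷_) (take-prefix u xs)

length-snoc : ∀ {A : Set} (u : List A) (a : A) → length (u ++ a ∷ []) ≡ suc (length u)
length-snoc u a = trans (length-++ u) (+-comm (length u) 1)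

module Matching {A : Set} (_≟A_ : DecidableEquality A) (P : List A) where

  M : ℕ
  M = length P

  EndsWith : List A → ℕ → Set
  EndsWith w k = Σ (List A) λ u → w ≡ u ++ take k P

  endsWith-zero : ∀ w → EndsWith w 0
  endsWith-zero w = w , sym (++-identityʳ w)

  at-take : ∀ s (xs : List A) {α} → at s xs ≡ just α → take (suc s) xs ≡ take s xs ++ α ∷ []
  at-take zero    (x ∷ xs) refl = refl
  at-take (suc s) (x ∷ xs) e    = cong (x ∷_) (at-take s xs e)

  endsWith-extend : ∀ {w s α} → EndsWith w s → at s P ≡ just α → EndsWith (w ++ α ∷ []) (suc s)
  endsWith-extend {w} {s} {α} (u , w≡) e = u , (begin
      w ++ α ∷ []                ≡⟨ cong (_++ α ∷ []) w≡ ⟩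
      (u ++ take s P) ++ α ∷ []  ≡⟨ ++-assoc u (take s P) (α ∷ []) ⟩
      u ++ (take s P ++ α ∷ [])  ≡⟨ cong (u ++_) (at-take s P e) ⟨
      u ++ take (suc s) P        ∎)
    where open ≡-Reasoning

  endsWith-border : ∀ {w s k} → EndsWith w s → take k P ≡ drop (s ∸ k) (take s P) → EndsWith w k
  endsWith-border {w} {s} {k} (u , w≡) border = u ++ take (s ∸ k) (take s P) , (begin
      w                                                   ≡⟨ w≡ ⟩
      u ++ take s P                                       ≡⟨ cong (u ++_) (take++drop≡id (s ∸ k) (take s P)) ⟨
      u ++ (take (s ∸ k) (take s P) ++ drop (s ∸ k) (take s P))  ≡⟨ ++-assoc u _ _ ⟨
      (u ++ take (s ∸ k) (take s P)) ++ drop (s ∸ k) (take s P)  ≡⟨ cong ((u ++ take (s ∸ k) (take s P)) ++_) border ⟨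
      (u ++ take (s ∸ k) (take s P)) ++ take k P          ∎)
    where open ≡-Reasoning

  failSearch≤ : ∀ s k → failSearch _≟A_ P s k ≤ k
  failSearch≤ s zero = z≤n
  failSearch≤ s (suc k) with isBorder _≟A_ P s (suc k)
  ... | true  = ≤-refl
  ... | false = m≤n⇒m≤1+n (failSearch≤ s k)

  endsWith-failSearch : ∀ {w} s k → EndsWith w s → EndsWith w (failSearch _≟A_ P s k)
  endsWith-failSearch {w} s zero    _    = endsWith-zero w
  endsWith-failSearch     s (suc k) ends with isBorder _≟A_ P s (suc k) in e
  ... | true  = endsWith-border ends (does-true (≡-dec _≟A_ _ _) (∧-conicalʳ _ _ e))
  ... | false = endsWith-failSearch s k ends

  fail< : ∀ s → s ≢ 0 → fail _≟A_ P s < s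
  fail< zero    s≢0 = ⊥-elim (s≢0 refl)
  fail< (suc s) _   = s≤s (failSearch≤ (suc s) s)

  endsWith-fail : ∀ {w} s → EndsWith w s → EndsWith w (fail _≟A_ P s)
  endsWith-fail s = endsWith-failSearch s (s ∸ 1)

  occurrence : ∀ {Q w rest} → Q ≡ w ++ rest → EndsWith w M → occAt _≟A_ P Q (length w) ≡ true
  occurrence {Q} {w} {rest} Q≡ (u , w≡) =
    subst₂ (λ R k → occAt _≟A_ P R k ≡ true) (sym Q≡u) (sym |w|≡) found
    where
    w≡uP : w ≡ u ++ P
    w≡uP = trans w≡ (cong (u ++_) (take-all M P ≤-refl))
    Q≡u : Q ≡ u ++ (P ++ rest)
    Q≡u = trans Q≡ (trans (cong (_++ rest) w≡uP) (++-assoc u P rest))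
    |w|≡ : length w ≡ length u + M
    |w|≡ = trans (cong length w≡uP) (length-++ u)
    window : take M (drop (length u + M ∸ M) (u ++ (P ++ rest))) ≡ P
    window = begin
      take M (drop (length u + M ∸ M) (u ++ (P ++ rest)))  ≡⟨ cong (λ k → take M (drop k (u ++ (P ++ rest)))) (m+n∸n≡m (length u) M) ⟩
      take M (drop (length u) (u ++ (P ++ rest)))          ≡⟨ cong (take M) (drop-prefix u (P ++ rest)) ⟩
      take M (P ++ rest)                                   ≡⟨ take-prefix P rest ⟩
      P                                                    ∎
      where open ≡-Reasoning
    found : occAt _≟A_ P (u ++ (P ++ rest)) (length u + M) ≡ true
    found = cong₂ _∧_ (dec-true (M ≤? length u + M) (m≤n+m M (length u)))
                      (dec-true (≡-dec _≟A_ _ P) window)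

  accepting≤occurrence : ∀ {Q w rest s} → Q ≡ w ++ rest → EndsWith w s → (s≟M : Dec (s ≡ M)) →
                         bit (does s≟M) ≤ bit (occAt _≟A_ P Q (length w))
  accepting≤occurrence Q≡ ends (yes refl) = ≤-reflexive (cong bit (sym (occurrence Q≡ ends)))
  accepting≤occurrence Q≡ ends (no _)     = z≤n

  occAfter : List A → ℕ → ℕ → ℕ
  occAfter Q k zero    = 0
  occAfter Q k (suc n) = bit (occAt _≟A_ P Q (suc k)) + occAfter Q (suc k) n

  occAfter≡count : ∀ Q k n (f : ℕ → ℕ) → (∀ x → f x ≡ suc (k + x)) →
                   occAfter Q k n ≡ countUpTo _≟A_ P Q (applyUpTo f n)
  occAfter≡count Q k zero    f f≡ = refl
  occAfter≡count Q k (suc n) f f≡ = cong₂ _+_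
    (cong (λ x → bit (occAt _≟A_ P Q x)) (sym (trans (f≡ 0) (cong suc (+-identityʳ k)))))
    (occAfter≡count Q (suc k) n (λ x → f (suc x)) (λ x → trans (f≡ (suc x)) (cong suc (+-suc k x))))

  -- occ counts the end positions 0, 1, …, |Q|; position 0 only adds.
  occAfter≤occ : ∀ Q → occAfter Q 0 (length Q) ≤ occ _≟A_ P Q
  occAfter≤occ Q = subst (_≤ occ _≟A_ P Q) (sym (occAfter≡count Q 0 (length Q) suc (λ _ → refl)))
                         (m≤n+m _ _)

chain-cost : ∀ r a b x y z K → r * a + y ≤ z → r * b + x ≤ y + K → r * (a + b) + x ≤ z + K
chain-cost r a b x y z K first rest = begin
    r * (a + b) + x        ≡⟨ normalize r a b x ⟩
    r * a + (r * b + x)    ≤⟨ +-monoʳ-≤ (r * a) rest ⟩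
    r * a + (y + K)        ≡⟨ +-assoc (r * a) y K ⟨
    r * a + y + K          ≤⟨ +-monoˡ-≤ K first ⟩
    z + K                  ∎
  where
  open ≤-Reasoning
  normalize : ∀ r a b x → r * (a + b) + x ≡ r * a + (r * b + x)
  normalize = solve-∀

-- Amortization potential of the state at offset j of a segment starting at K-state l,
-- where h = r/2.  The summand 8l + 6j = 2l + 6(l + j) pays for moves between segments;
-- the summand 12 (j ∸ h) is credit collected in the right half of a segment that pays
-- for the heavy forward move leaving it at its right end.
pot : ℕ → ℕ → ℕ → ℕ
pot h l j = 8 * l + 6 * j + 12 * (j ∸ h)

suc∸≤suc[∸] : ∀ j h → suc j ∸ h ≤ suc (j ∸ h)
suc∸≤suc[∸] j h = m≤n+o⇒m∸n≤o (suc j) h (subst (suc j ≤_) (sym (+-suc h (j ∸ h))) (s≤s (m≤n+m∸n j h)))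

pot-suc : ∀ h l j → pot h l (suc j) ≤ pot h l j + 18
pot-suc h l j = begin
    8 * l + 6 * suc j + 12 * (suc j ∸ h)  ≤⟨ +-monoʳ-≤ (8 * l + 6 * suc j) (*-monoʳ-≤ 12 (suc∸≤suc[∸] j h)) ⟩
    8 * l + 6 * suc j + 12 * suc (j ∸ h)  ≡⟨ normalize l j (j ∸ h) ⟩
    8 * l + 6 * j + 12 * (j ∸ h) + 18     ∎
  where
  open ≤-Reasoning
  normalize : ∀ l j x → 8 * l + 6 * suc j + 12 * suc x ≡ 8 * l + 6 * j + 12 * x + 18
  normalize = solve-∀

pot-mono : ∀ h l {j' j} → j' ≤ j → pot h l j' ≤ pot h l j
pot-mono h l j'≤j = +-mono-≤ (+-monoʳ-≤ (8 * l) (*-monoʳ-≤ 6 j'≤j)) (*-monoʳ-≤ 12 (∸-monoˡ-≤ h j'≤j))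

pot-left : ∀ h l j → j ≤ h → pot h l j ≡ 2 * l + 6 * (l + j)
pot-left h l j j≤h = begin
    8 * l + 6 * j + 12 * (j ∸ h)  ≡⟨ cong (λ x → 8 * l + 6 * j + 12 * x) (m≤n⇒m∸n≡0 j≤h) ⟩
    8 * l + 6 * j + 12 * 0        ≡⟨ normalize l j ⟩
    2 * l + 6 * (l + j)           ∎
  where
  open ≡-Reasoning
  normalize : ∀ l j → 8 * l + 6 * j + 12 * 0 ≡ 2 * l + 6 * (l + j)
  normalize = solve-∀

pot-exit-right : ∀ h l j l' j' → suc j ≡ h + h → l' + j' ≡ suc (l + j) → l + h ≤ l' →
                 h + h + pot h l' j' ≤ pot h l j + 18
pot-exit-right zero    l j l' j' () _ _
pot-exit-right (suc h) l j l' j' last land l+H≤l' = begin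
    H + H + pot H l' j'               ≡⟨ cong (H + H +_) (pot-left H l' j' j'≤H) ⟩
    H + H + (2 * l' + 6 * (l' + j'))  ≤⟨ +-monoʳ-≤ (H + H) (+-mono-≤ (*-monoʳ-≤ 2 l'≤) (≤-reflexive (cong (6 *_) land'))) ⟩
    H + H + (2 * (l + (H + H)) + 6 * (l + (H + H)))  ≡⟨ normalize₁ l h ⟩
    8 * l + 18 * H                    ≤⟨ m≤m+n (8 * l + 18 * H) (6 * H) ⟩
    8 * l + 18 * H + 6 * H            ≡⟨ normalize₂ l h ⟩
    8 * l + 6 * (h + H) + 12 * h + 18 ≡⟨ cong (λ x → 8 * l + 6 * (h + H) + 12 * x + 18) j-excess ⟨
    8 * l + 6 * (h + H) + 12 * ((h + H) ∸ H) + 18  ≡⟨ cong (λ x → 8 * l + 6 * x + 12 * (x ∸ H) + 18) j≡ ⟨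
    pot H l j + 18                    ∎
  where
  open ≤-Reasoning
  H = suc h
  j≡ : j ≡ h + H
  j≡ = suc-injective last
  j-excess : (h + H) ∸ H ≡ h
  j-excess = m+n∸n≡m h H
  land' : l' + j' ≡ l + (H + H)
  land' = trans land (trans (sym (+-suc l j)) (cong (l +_) last))
  l'≤ : l' ≤ l + (H + H)
  l'≤ = subst (l' ≤_) land' (m≤m+n l' j')
  j'≤H : j' ≤ H
  j'≤H = +-cancelˡ-≤ l' j' H (begin
    l' + j'          ≡⟨ land' ⟩
    l + (H + H)      ≡⟨ +-assoc l H H ⟨
    l + H + H        ≤⟨ +-monoˡ-≤ H l+H≤l' ⟩
    l' + H           ∎)
  normalize₁ : ∀ l h → suc h + suc h + (2 * (l + (suc h + suc h)) + 6 * (l + (suc h + suc h)))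
                       ≡ 8 * l + 18 * suc h
  normalize₁ = solve-∀
  normalize₂ : ∀ l h → 8 * l + 18 * suc h + 6 * suc h ≡ 8 * l + 6 * (h + suc h) + 12 * h + 18
  normalize₂ = solve-∀

pot-exit-left : ∀ h l j l' j' → l' + j' ≤ l + j → l' + h ≤ l → j' ≤ h → h + h + pot h l' j' ≤ pot h l j
pot-exit-left h l j l' j' land l'+h≤l j'≤h = begin
    h + h + pot h l' j'               ≡⟨ cong (h + h +_) (pot-left h l' j' j'≤h) ⟩
    h + h + (2 * l' + 6 * (l' + j'))  ≡⟨ normalize h l' (l' + j') ⟩
    2 * (l' + h) + 6 * (l' + j')      ≤⟨ +-mono-≤ (*-monoʳ-≤ 2 l'+h≤l) (*-monoʳ-≤ 6 land) ⟩
    2 * l + 6 * (l + j)               ≡⟨ normalize′ l j ⟩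
    8 * l + 6 * j                     ≤⟨ m≤m+n (8 * l + 6 * j) (12 * (j ∸ h)) ⟩
    pot h l j                         ∎
  where
  open ≤-Reasoning
  normalize : ∀ h l' s → h + h + (2 * l' + 6 * s) ≡ 2 * (l' + h) + 6 * s
  normalize = solve-∀
  normalize′ : ∀ l j → 2 * l + 6 * (l + j) ≡ 8 * l + 6 * j
  normalize′ = solve-∀

module Segments {A : Set} (_≟A_ : DecidableEquality A) (P : List A)
                (r : ℕ) (1<r : 1 < r) (r-even : r % 2 ≡ 0) where
  open Seg _≟A_ P r hiding (trans)
  open Matching _≟A_ P

  h : ℕ
  h = half

  q : ℕ
  q = div (M + 1) r

  r≡h+h : r ≡ h + h
  r≡h+h = begin
      r                    ≡⟨ m≡m%n+[m/n]*n r 2 ⟩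
      r % 2 + (r / 2) * 2  ≡⟨ cong (_+ (r / 2) * 2) r-even ⟩
      h * 2                ≡⟨ *-comm h 2 ⟩
      h + (h + 0)          ≡⟨ cong (h +_) (+-identityʳ h) ⟩
      h + h                ∎
    where open ≡-Reasoning

  1≤h : 1 ≤ h
  1≤h = n≢0⇒n>0 λ h≡0 → <⇒≱ 1<r (subst (_≤ 1) (sym (trans r≡h+h (cong₂ _+_ h≡0 h≡0))) z≤n)

  1≤r : 1 ≤ r
  1≤r = <⇒≤ 1<r

  z≡ : z ≡ suc (q + q)
  z≡ = trans (+-comm (2 * q) 1) (cong (λ x → suc (q + x)) (+-identityʳ q))

  _∈S_ : ℕ → ℕ → Set
  s ∈S i = lSeg i ≤ s × s ≤ rSeg i

  inSeg-sound : ∀ i {s} → inSeg i s ≡ true → s ∈S i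
  inSeg-sound i {s} = does-true ((lSeg i ≤? s) ×-dec (s ≤? rSeg i))

  inSeg-complete : ∀ i {s} → s ∈S i → inSeg i s ≡ true
  inSeg-complete i {s} = dec-true ((lSeg i ≤? s) ×-dec (s ≤? rSeg i))

  inSeg-false : ∀ i {s} → inSeg i s ≡ false → ¬ (s ∈S i)
  inSeg-false i e s∈i with trans (sym (inSeg-complete i s∈i)) e
  ... | ()

  lSeg-mono : ∀ {i k} → i ≤ k → lSeg i ≤ lSeg k
  lSeg-mono = *-monoˡ-≤ h

  rSeg≤M : ∀ i → rSeg i ≤ M
  rSeg≤M i = m⊓n≤n _ M

  rSeg-mono : ∀ i → rSeg i ≤ rSeg (suc i)
  rSeg-mono i = ⊓-monoˡ-≤ M (∸-monoˡ-≤ 1 (+-monoˡ-≤ r (m≤n+m (lSeg i) h)))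

  lSeg-last : lSeg (q + q) ≡ q * r
  lSeg-last = begin
      (q + q) * h    ≡⟨ *-distribʳ-+ h q q ⟩
      q * h + q * h  ≡⟨ *-distribˡ-+ q h h ⟨
      q * (h + h)    ≡⟨ cong (q *_) r≡h+h ⟨
      q * r          ∎
    where open ≡-Reasoning

  -- ... and reaches M, since M + 1 < (q + 1)·r.
  rSeg-last : rSeg (q + q) ≡ M
  rSeg-last = m≥n⇒m⊓n≡n (subst (λ l → M ≤ l + r ∸ 1) (sym lSeg-last)
                (m+n≤o⇒m≤o∸n M (<⇒≤ (<div*d+d (M + 1) r 1≤r))))

  full-length : ∀ i → rSeg i < M → rSeg i ≡ lSeg i + (r ∸ 1)
  full-length i rᵢ<M with ⊓-sel (lSeg i + r ∸ 1) M
  ... | inj₁ full = trans full (+-∸-assoc (lSeg i) 1≤r)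
  ... | inj₂ cut  = ⊥-elim (<-irrefl cut rᵢ<M)

  not-last : ∀ {i} → i < z → rSeg i < M → suc i < z
  not-last {i} i<z rᵢ<M = subst (suc i <_) (sym z≡) (s≤s (≤∧≢⇒< (≤-pred (subst (i <_) z≡ i<z))
    λ i≡2q → <-irrefl (trans (cong rSeg i≡2q) rSeg-last) rᵢ<M))

  covered : ∀ {s} → s ≤ M → Σ ℕ λ k → k < z × s ∈S k
  covered {s} s≤M with div s h <? q + q
  ... | yes k<2q = div s h , subst (div s h <_) (sym z≡) (m<n⇒m<1+n k<2q) ,
                   div*d≤ s h , ⊓-glb (m+n≤o⇒m≤o∸n s (subst (_≤ lSeg (div s h) + r) (+-comm 1 s) s<l+r)) s≤M
    where
    s<l+r : suc s ≤ lSeg (div s h) + r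
    s<l+r = ≤-trans (<div*d+d s h 1≤h) (+-monoʳ-≤ (lSeg (div s h)) (subst (h ≤_) (sym r≡h+h) (m≤m+n h h)))
  ... | no  k≮2q = q + q , subst (q + q <_) (sym z≡) ≤-refl ,
                   ≤-trans (lSeg-mono (≮⇒≥ k≮2q)) (div*d≤ s h) , subst (s ≤_) (sym rSeg-last) s≤M

  segSearch-spec : ∀ {s k} b → k < b → s ∈S k →
                   segSearch s b < b × s ∈S segSearch s b × k ≤ segSearch s b
  segSearch-spec {s} {k} (suc b) k<1+b s∈k with inSeg b s in e
  ... | true  = ≤-refl , inSeg-sound b e , ≤-pred k<1+b
  ... | false = m<n⇒m<1+n (proj₁ found) , proj₂ found
    where
    k≢b : k ≢ b
    k≢b refl = inSeg-false b e s∈k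
    found = segSearch-spec b (≤∧≢⇒< (≤-pred k<1+b) k≢b) s∈k

  target<z : ∀ {s} → s ≤ M → target s < z
  target<z s≤M = let k , k<z , s∈k = covered s≤M in proj₁ (segSearch-spec z k<z s∈k)

  target-mem : ∀ {s} → s ≤ M → s ∈S target s
  target-mem s≤M = let k , k<z , s∈k = covered s≤M in proj₁ (proj₂ (segSearch-spec z k<z s∈k))

  target-max : ∀ {s k} → k < z → s ∈S k → k ≤ target s
  target-max k<z s∈k = proj₂ (proj₂ (segSearch-spec z k<z s∈k))

  -- Unless target s is the last segment, s lies in its left half: otherwise the next
  -- segment, starting h later, would contain s as well.
  left-half : ∀ {s} → s ≤ M → suc (target s) < z → s < lSeg (target s) + h
  left-half {s} s≤M next<z with s <? lSeg (target s) + h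
  ... | yes in-left = in-left
  ... | no  ¬left   = ⊥-elim (1+n≰n (target-max next<z s∈next))
    where
    T = target s
    s∈next : s ∈S suc T
    s∈next = subst (_≤ s) (+-comm (lSeg T) h) (≮⇒≥ ¬left) ,
             ≤-trans (proj₂ (target-mem s≤M)) (rSeg-mono T)

  -- The pairs that are states of C(P,r): an existing segment and an offset inside it.
  -- (The automaton's type allows any pair; the simulation never leaves these.)
  Valid : State → Set
  Valid (i , j) = i < z × lSeg i + j ≤ rSeg i

  pos : State → ℕ
  pos (i , j) = lSeg i + j

  pos≤M : ∀ {st} → Valid st → pos st ≤ M
  pos≤M {i , j} (_ , in-seg) = ≤-trans in-seg (rSeg≤M i)

  enter : ∀ {i s} → i < z → s ∈S i → Valid (i , s ∸ lSeg i) × pos (i , s ∸ lSeg i) ≡ s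
  enter {i} {s} i<z (l≤s , s≤r) = (i<z , subst (_≤ rSeg i) (sym back) s≤r) , back
    where
    back : lSeg i + (s ∸ lSeg i) ≡ s
    back = m+[n∸m]≡n l≤s

  lands : ∀ {i j} s' k acc → Valid (i , j) → s' ≤ M →
          Valid (Trans.tgt (mkTrans (i , j) s' k acc)) × pos (Trans.tgt (mkTrans (i , j) s' k acc)) ≡ s'
  lands {i} s' k acc (i<z , _) s'≤M with inSeg i s' in e
  ... | true  = enter i<z (inSeg-sound i e)
  ... | false = enter (target<z s'≤M) (target-mem s'≤M)

  -- Then S_i has full length r,
  -- so j = r - 1, and the new K-state l_i + r lies in S_{i+1}, so the target segment
  -- starts at or after l_{i+1} = l_i + h.
  exit-right : ∀ {i j} → Valid (i , j) → lSeg i + j < M → inSeg i (suc (lSeg i + j)) ≡ false →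
               suc j ≡ h + h × lSeg i + h ≤ lSeg (target (suc (lSeg i + j)))
  exit-right {i} {j} (i<z , s≤rᵢ) s<M e =
    last , subst (_≤ lSeg T) (+-comm h l) (lSeg-mono (target-max (not-last i<z rᵢ<M) s'∈next))
    where
    l = lSeg i
    s = l + j
    T = target (suc s)
    rᵢ≡s : rSeg i ≡ s
    rᵢ≡s with suc s ≤? rSeg i
    ... | yes s'≤rᵢ = ⊥-elim (inSeg-false i e (≤-trans (m≤m+n l j) (n≤1+n s) , s'≤rᵢ))
    ... | no  s'≰rᵢ = ≤-antisym (≤-pred (≰⇒> s'≰rᵢ)) s≤rᵢ
    rᵢ<M : rSeg i < M
    rᵢ<M = subst (_< M) (sym rᵢ≡s) s<M
    last : suc j ≡ h + h
    last = begin
        suc j          ≡⟨ cong suc (+-cancelˡ-≡ l j (r ∸ 1) (trans (sym rᵢ≡s) (full-length i rᵢ<M))) ⟩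
        suc (r ∸ 1)    ≡⟨ +-comm 1 (r ∸ 1) ⟩
        r ∸ 1 + 1      ≡⟨ m∸n+n≡m 1≤r ⟩
        r              ≡⟨ r≡h+h ⟩
        h + h          ∎
      where open ≡-Reasoning
    s'≡ : suc s ≡ l + (h + h)
    s'≡ = trans (sym (+-suc l j)) (cong (l +_) last)
    s'∈next : suc s ∈S suc i
    s'∈next = subst (h + l ≤_) (sym s'≡) (subst (_≤ l + (h + h)) (+-comm l h) (+-monoʳ-≤ l (m≤m+n h h))) ,
              ⊓-glb (m+n≤o⇒m≤o∸n (suc s) (begin
                suc s + 1          ≡⟨ cong (_+ 1) s'≡ ⟩
                l + (h + h) + 1    ≤⟨ +-monoʳ-≤ (l + (h + h)) 1≤h ⟩
                l + (h + h) + h    ≡⟨ normalize l h ⟩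
                h + l + (h + h)    ≡⟨ cong (h + l +_) r≡h+h ⟨
                h + l + r          ∎)) s<M
      where
      open ≤-Reasoning
      normalize : ∀ l h → l + (h + h) + h ≡ h + l + (h + h)
      normalize = solve-∀

  -- A failure move leaves S_i only to a K-state s' < l_i.  Its target segment then
  -- starts at least h before l_i and is not the last one, so s' is in its left half.
  exit-left : ∀ {i j s'} → Valid (i , j) → s' < lSeg i + j → inSeg i s' ≡ false →
              lSeg (target s') + h ≤ lSeg i × s' ∸ lSeg (target s') ≤ h
  exit-left {i} {j} {s'} (i<z , s≤rᵢ) s'<s e =
    subst (_≤ lSeg i) (+-comm h (lSeg T)) (lSeg-mono T<i) ,
    m≤n+o⇒m∸n≤o s' (lSeg T) (<⇒≤ (left-half s'≤M (≤-<-trans T<i i<z)))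
    where
    s'≤M : s' ≤ M
    s'≤M = ≤-trans (<⇒≤ s'<s) (≤-trans s≤rᵢ (rSeg≤M i))
    s'<l : s' < lSeg i
    s'<l with lSeg i ≤? s'
    ... | yes l≤s' = ⊥-elim (inSeg-false i e (l≤s' , ≤-trans (<⇒≤ s'<s) s≤rᵢ))
    ... | no  l≰s' = ≰⇒> l≰s'
    T = target s'
    T<i : T < i
    T<i = *-cancelʳ-< h T i (≤-<-trans (proj₁ (target-mem s'≤M)) s'<l)

module Accounting {A : Set} (_≟A_ : DecidableEquality A) (P : List A)
                  (r : ℕ) (1<r : 1 < r) (r-even : r % 2 ≡ 0) where
  open Seg _≟A_ P r hiding (trans)
  open Matching _≟A_ P
  open Segments _≟A_ P r 1<r r-even

  Φ : State → ℕ
  Φ (i , j) = pot h (lSeg i) j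

  haBit : Trans → ℕ
  haBit t = bit (isHeavyOrAccepting t)

  r*1≡h+h : r * 1 ≡ h + h
  r*1≡h+h = trans (*-identityʳ r) r≡h+h

  forward-cost : ∀ {i j} k acc → Valid (i , j) → lSeg i + j < M →
    r * haBit (mkTrans (i , j) (suc (lSeg i + j)) k acc)
      + Φ (Trans.tgt (mkTrans (i , j) (suc (lSeg i + j)) k acc)) ≤ Φ (i , j) + (18 + r * bit acc)
  forward-cost {i} {j} k acc v s<M with inSeg i (suc (lSeg i + j)) in e
  ... | true  = begin
      r * bit acc + pot h l (suc (l + j) ∸ l)  ≡⟨ cong (λ x → r * bit acc + pot h l x) offset ⟩
      r * bit acc + pot h l (suc j)            ≤⟨ +-monoʳ-≤ (r * bit acc) (pot-suc h l j) ⟩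
      r * bit acc + (pot h l j + 18)           ≡⟨ normalize (r * bit acc) (pot h l j) ⟩
      pot h l j + (18 + r * bit acc)           ∎
    where
    open ≤-Reasoning
    l = lSeg i
    offset : suc (l + j) ∸ l ≡ suc j
    offset = trans (cong (_∸ l) (sym (+-suc l j))) (m+n∸m≡n l (suc j))
    normalize : ∀ a p → a + (p + 18) ≡ p + (18 + a)
    normalize = solve-∀
  ... | false = begin
      r * 1 + pot h lT (s' ∸ lT)  ≡⟨ cong (_+ pot h lT (s' ∸ lT)) r*1≡h+h ⟩
      h + h + pot h lT (s' ∸ lT)  ≤⟨ pot-exit-right h l j lT (s' ∸ lT) last land l+h≤lT ⟩
      pot h l j + 18              ≤⟨ +-monoʳ-≤ (pot h l j) (m≤m+n 18 (r * bit acc)) ⟩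
      pot h l j + (18 + r * bit acc)  ∎
    where
    open ≤-Reasoning
    l = lSeg i
    s' = suc (l + j)
    lT = lSeg (target s')
    last = proj₁ (exit-right v s<M e)
    l+h≤lT = proj₂ (exit-right v s<M e)
    land : lT + (s' ∸ lT) ≡ s'
    land = m+[n∸m]≡n (proj₁ (target-mem s<M))

  failure-cost : ∀ {i j} s' k → Valid (i , j) → s' < lSeg i + j →
    r * haBit (mkTrans (i , j) s' k false) + Φ (Trans.tgt (mkTrans (i , j) s' k false)) ≤ Φ (i , j)
  failure-cost {i} {j} s' k v s'<s with inSeg i s' in e
  ... | true  = begin
      r * 0 + pot h l (s' ∸ l)  ≡⟨ cong (_+ pot h l (s' ∸ l)) (*-zeroʳ r) ⟩
      pot h l (s' ∸ l)          ≤⟨ pot-mono h l (m≤n+o⇒m∸n≤o s' l (<⇒≤ s'<s)) ⟩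
      pot h l j                 ∎
    where
    open ≤-Reasoning
    l = lSeg i
  ... | false = begin
      r * 1 + pot h lT (s' ∸ lT)  ≡⟨ cong (_+ pot h lT (s' ∸ lT)) r*1≡h+h ⟩
      h + h + pot h lT (s' ∸ lT)  ≤⟨ pot-exit-left h l j lT (s' ∸ lT) land' lT+h≤l offset≤h ⟩
      pot h l j                   ∎
    where
    open ≤-Reasoning
    l = lSeg i
    lT = lSeg (target s')
    lT+h≤l = proj₁ (exit-left v s'<s e)
    offset≤h = proj₂ (exit-left v s'<s e)
    land' : lT + (s' ∸ lT) ≤ l + j
    land' = subst (_≤ l + j) (sym (m+[n∸m]≡n (proj₁ (target-mem (≤-trans (<⇒≤ s'<s) (pos≤M v))))))
                  (<⇒≤ s'<s)

  fwdOK-sound : ∀ s α → fwdOK s α ≡ true → at s P ≡ just α × s < M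
  fwdOK-sound s α ok with at s P
  ... | just c  = cong just (does-true (c ≟A α) (∧-conicalˡ _ _ ok)) ,
                  does-true (s <? M) (∧-conicalʳ _ _ ok)
  fwdOK-sound s α () | nothing

  record StepBound (Q w : List A) (st : State) (res : List Trans × State) : Set where
    field
      valid   : Valid (proj₂ res)
      matched : EndsWith w (pos (proj₂ res))
      cost    : r * countHA (proj₁ res) + Φ (proj₂ res) ≤ Φ st + (18 + r * bit (occAt _≟A_ P Q (length w)))

  failMove : ℕ → ℕ → Trans
  failMove i j = mkTrans (i , j) (fail _≟A_ P (lSeg i + j)) failure false

  -- Reading one character, with enough fuel for the failure chain (pos st < f).  Stated
  -- ahead of its proof since it is mutually recursive with miss-bound.
  step-bound : ∀ {Q pre rest} α f st → Q ≡ pre ++ α ∷ rest → Valid st → pos st < f →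
               EndsWith pre (pos st) → StepBound Q (pre ++ α ∷ []) st (step f st α)

  -- The branch of `step` taken when the forward test fails, whichever way s ≡ 0 is decided.
  miss-bound : ∀ {Q pre rest} α f i j → Q ≡ pre ++ α ∷ rest → Valid (i , j) → lSeg i + j ≤ f →
               EndsWith pre (lSeg i + j) → (s≟0 : Dec (lSeg i + j ≡ 0)) →
               StepBound Q (pre ++ α ∷ []) (i , j)
                 (if does s≟0 then ([] , (i , j))
                  else ((failMove i j ∷ proj₁ (step f (Trans.tgt (failMove i j)) α)) ,
                        proj₂ (step f (Trans.tgt (failMove i j)) α)))
  miss-bound {pre = pre} α f i j Q≡ v s≤f ends (yes s≡0) = record
    { valid   = v
    ; matched = subst (EndsWith (pre ++ α ∷ [])) (sym s≡0) (endsWith-zero (pre ++ α ∷ []))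
    ; cost    = ≤-trans (≤-reflexive (cong (_+ Φ (i , j)) (*-zeroʳ r))) (m≤m+n (Φ (i , j)) _)
    }
  miss-bound {pre = pre} α f i j Q≡ v s≤f ends (no s≢0) = record
    { valid   = StepBound.valid IH
    ; matched = StepBound.matched IH
    ; cost    = chain-cost r (haBit (failMove i j)) _ _ _ _ _ (failure-cost s' failure v fail<s) (StepBound.cost IH)
    }
    where
    s = lSeg i + j
    s' = fail _≟A_ P s
    fail<s = fail< s s≢0
    landing = lands s' failure false v (≤-trans (<⇒≤ fail<s) (pos≤M v))
    IH = step-bound α f (Trans.tgt (failMove i j)) Q≡ (proj₁ landing)
           (subst (_< f) (sym (proj₂ landing)) (<-≤-trans fail<s s≤f))
           (subst (EndsWith pre) (sym (proj₂ landing)) (endsWith-fail s ends))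

  step-bound α zero    st      Q≡ v () ends
  step-bound {Q} {pre} {rest} α (suc f) (i , j) Q≡ v s<f ends with fwdOK (lSeg i + j) α in ok
  ... | true = record
    { valid   = proj₁ landing
    ; matched = subst (EndsWith (pre ++ α ∷ [])) (sym (proj₂ landing)) (endsWith-extend ends P[s]≡α)
    ; cost    = begin
        r * (haBit t + 0) + Φ (Trans.tgt t)  ≡⟨ cong (λ x → r * x + Φ (Trans.tgt t)) (+-identityʳ (haBit t)) ⟩
        r * haBit t + Φ (Trans.tgt t)        ≤⟨ forward-cost (forward α) (does (suc s ≟ M)) v s<M ⟩
        Φ (i , j) + (18 + r * bit (does (suc s ≟ M)))
          ≤⟨ +-monoʳ-≤ (Φ (i , j)) (+-monoʳ-≤ 18 (*-monoʳ-≤ r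
               (accepting≤occurrence (trans Q≡ (sym (++-assoc pre (α ∷ []) rest)))
                                     (endsWith-extend ends P[s]≡α) (suc s ≟ M)))) ⟩
        Φ (i , j) + (18 + r * bit (occAt _≟A_ P Q (length (pre ++ α ∷ []))))  ∎
    }
    where
    open ≤-Reasoning
    s = lSeg i + j
    P[s]≡α = proj₁ (fwdOK-sound s α ok)
    s<M = proj₂ (fwdOK-sound s α ok)
    t = mkTrans (i , j) (suc s) (forward α) (does (suc s ≟ M))
    landing = lands (suc s) (forward α) (does (suc s ≟ M)) v s<M
  ... | false = miss-bound α f i j Q≡ v (≤-pred s<f) ends (lSeg i + j ≟ 0)

  countHA-++ : ∀ xs ys → countHA (xs ++ ys) ≡ countHA xs + countHA ys
  countHA-++ []       ys = refl
  countHA-++ (t ∷ xs) ys = trans (cong (haBit t +_) (countHA-++ xs ys)) (sym (+-assoc (haBit t) _ _))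

  run-bound : ∀ {Q} pre rest st → Q ≡ pre ++ rest → Valid st → EndsWith pre (pos st) →
              r * countHA (run rest st) ≤ Φ st + (18 * length rest + r * occAfter Q (length pre) (length rest))
  run-bound pre []         st Q≡ v ends = ≤-trans (≤-reflexive (*-zeroʳ r)) z≤n
  run-bound {Q} pre (α ∷ rest) st Q≡ v ends = begin
      r * countHA (ts ++ run rest st')                   ≡⟨ cong (r *_) (countHA-++ ts (run rest st')) ⟩
      r * (countHA ts + countHA (run rest st'))          ≡⟨ *-distribˡ-+ r (countHA ts) _ ⟩
      r * countHA ts + r * countHA (run rest st')        ≤⟨ +-monoʳ-≤ (r * countHA ts) IH ⟩
      r * countHA ts + (Φ st' + (18 * n + r * later))   ≡⟨ +-assoc (r * countHA ts) (Φ st') _ ⟨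
      r * countHA ts + Φ st' + (18 * n + r * later)     ≤⟨ +-monoˡ-≤ _ (StepBound.cost S) ⟩
      Φ st + (18 + r * here) + (18 * n + r * later)      ≡⟨ normalize (Φ st) n r here later ⟩
      Φ st + (18 * suc n + r * (here + later))           ≡⟨ cong (λ k → Φ st + (18 * suc n + r * (bit (occAt _≟A_ P Q k) + occAfter Q k n)))
                                                              (length-snoc pre α) ⟩
      Φ st + (18 * suc n + r * occAfter Q (length pre) (suc n))  ∎
    where
    open ≤-Reasoning
    n = length rest
    pre′ = pre ++ α ∷ []
    ts = proj₁ (step (M + 1) st α)
    st' = proj₂ (step (M + 1) st α)
    here = bit (occAt _≟A_ P Q (length pre′))
    later = occAfter Q (length pre′) n
    S = step-bound α (M + 1) st Q≡ v (≤-<-trans (pos≤M v) (m<m+n M ≤-refl)) ends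
    IH = run-bound pre′ rest st' (trans Q≡ (sym (++-assoc pre (α ∷ []) rest)))
                   (StepBound.valid S) (StepBound.matched S)
    normalize : ∀ p n r a b → p + (18 + r * a) + (18 * n + r * b) ≡ p + (18 * suc n + r * (a + b))
    normalize = solve-∀

  simulation-bound : ∀ Q → r * heavyOrAccepting _≟A_ P r Q ≤ 18 * (length Q + r * occ _≟A_ P Q)
  simulation-bound Q = begin
      r * countHA (run Q (0 , 0))                 ≤⟨ run-bound [] Q (0 , 0) refl initial (endsWith-zero []) ⟩
      Φ (0 , 0) + (18 * n + r * occAfter Q 0 n)   ≡⟨ cong (_+ (18 * n + r * occAfter Q 0 n)) Φ-initial ⟩
      18 * n + r * occAfter Q 0 n                 ≤⟨ +-monoʳ-≤ (18 * n) (*-monoʳ-≤ r (occAfter≤occ Q)) ⟩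
      18 * n + r * occ _≟A_ P Q                   ≤⟨ +-monoʳ-≤ (18 * n) (m≤n*m (r * occ _≟A_ P Q) 18) ⟩
      18 * n + 18 * (r * occ _≟A_ P Q)            ≡⟨ *-distribˡ-+ 18 n (r * occ _≟A_ P Q) ⟨
      18 * (n + r * occ _≟A_ P Q)                 ∎
    where
    open ≤-Reasoning
    n = length Q
    initial : Valid (0 , 0)
    initial = subst (0 <_) (sym z≡) (s≤s z≤n) , z≤n
    Φ-initial : Φ (0 , 0) ≡ 0
    Φ-initial = cong (12 *_) (0∸n≡0 h)

lemma2 : Σ ℕ (λ c → 0 < c × ((A : Set) (_≟A_ : DecidableEquality A) (P Q : List A) (r : ℕ) → 1 < r → r ≤ length P + 1 → r % 2 ≡ 0 → r * heavyOrAccepting _≟A_ P r Q ≤ c * (length Q + r * occ _≟A_ P Q)))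
lemma2 = 18 , s≤s z≤n , λ A _≟A_ P Q r 1<r _ r-even → Accounting.simulation-bound _≟A_ P r 1<r r-even Q
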